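{- Let $(\mathcal{L},\mathcal{G})$ be a built lattice and let $G<G'$ be elements of $\mathcal{L}$. Then the map $\mathrm{Comp}_G:\mathrm{Ind}_{[G,G']}(\mathcal{G})\to\mathcal{G}$ is injective.
   Context: A finite lattice $\mathcal{L}$ (bottom $\hat 0$, top $\hat 1$) is geometric if all maximal chains between two comparable elements have the same length, the rank function $\rho$ satisfies $\rho(X\wedge Y)+\rho(X\vee Y)\le\rho(X)+\rho(Y)$, and every element is a join of atoms. A building set of $\mathcal{L}$ is a subset $\mathcal{G}\subset\mathcal{L}\setminus\{\hat0\}$ such that for every $X\in\mathcal{L}$, with $\mathrm{Fact}_{\mathcal{G}}(X)$ the set of maximal elements of $\mathcal{G}\cap[\hat0,X]$, the join map $\prod_{G\in\mathrm{Fact}_{\mathcal{G}}(X)}[\hat0,G]\to[\hat0,X]$ is a poset isomorphism; $(\mathcal{L},\mathcal{G})$ is then called a built lattice. For $G<G'$, $\mathrm{Ind}_{[G,G']}(\mathcal{G})=\big(\{G\vee F:F\in\mathcal{G}\}\cap[G,G']\big)\setminus\{G\}$. For $G''\in\mathrm{Ind}_{[G,G']}(\mathcal{G})$ there is a unique maximal element $F\in\mathcal{G}$ with $F\vee G=G''$; it is denoted $\mathrm{Comp}_G(G'')$. -}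

module Defs where

open import Level using (0ℓ)
open import Data.Nat using (ℕ; zero; suc; _+_) renaming (_≤_ to _≤ℕ_)
open import Data.List using (List; []; _∷_; foldr)
open import Data.List.Membership.Propositional using (_∈_)
open import Data.List.Relation.Unary.All using (All)
open import Data.List.Relation.Unary.Unique.Propositional using (Unique)
open import Data.List.Relation.Binary.Pointwise using (Pointwise)
open import Data.Product using (Σ; ∃; ∃-syntax; _×_; _,_)
open import Data.Sum using (_⊎_)
open import Relation.Nullary using (¬_)
open import Relation.Binary using (Rel; IsPartialOrder; Minimum; Maximum)
open import Relation.Binary.Lattice.Definitions using (Supremum; Infimum)
open import Relation.Binary.PropositionalEquality using (_≡_)
open import Function.Bundles using (_⇔_)

record FiniteLattice : Set₁ where
  infix 4 _≤_
  infixr 6 _∨_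
  infixr 7 _∧_
  field
    Carrier        : Set
    _≤_            : Rel Carrier 0ℓ
    isPartialOrder : IsPartialOrder _≡_ _≤_
    _∨_            : Carrier → Carrier → Carrier
    _∧_            : Carrier → Carrier → Carrier
    ∨-supremum     : Supremum _≤_ _∨_
    ∧-infimum      : Infimum _≤_ _∧_
    𝟘              : Carrier
    𝟙              : Carrier
    𝟘-minimum      : Minimum _≤_ 𝟘
    𝟙-maximum      : Maximum _≤_ 𝟙
    elements       : List Carrier
    elements-complete : ∀ x → x ∈ elements

module _ (L : FiniteLattice) where
  open FiniteLattice L

  _<_ : Carrier → Carrier → Set
  x < y = x ≤ y × ¬ (x ≡ y)

  _⋖_ : Carrier → Carrier → Set
  x ⋖ y = x < y × (∀ z → x ≤ z → z ≤ y → z ≡ x ⊎ z ≡ y)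

  data MaxChain : Carrier → Carrier → ℕ → Set where
    done : ∀ {x} → MaxChain x x 0
    step : ∀ {x y z n} → x ⋖ y → MaxChain y z n → MaxChain x z (suc n)

  ⋁ : List Carrier → Carrier
  ⋁ = foldr _∨_ 𝟘

  IsAtom : Carrier → Set
  IsAtom a = 𝟘 ⋖ a

  record IsGeometric : Set where
    field
      graded : ∀ {x y m n} → x ≤ y → MaxChain x y m → MaxChain x y n → m ≡ n
      -- semimodularity of the rank ρ(X) = length of a maximal chain 0̂ → X
      semimodular : ∀ X Y {a b c d} →
        MaxChain 𝟘 (X ∧ Y) a → MaxChain 𝟘 (X ∨ Y) b →
        MaxChain 𝟘 X c → MaxChain 𝟘 Y d → a + b ≤ℕ c + d
      atomistic : ∀ X → ∃[ as ] (All IsAtom as × ⋁ as ≡ X)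

  IsFact : (Carrier → Set) → Carrier → Carrier → Set
  IsFact 𝒢 X G = 𝒢 G × G ≤ X × (∀ G' → 𝒢 G' → G' ≤ X → G ≤ G' → G' ≡ G)

  -- Building set: 𝒢 ⊆ L ∖ {0̂}, and for every X the join map
  --   ∏_{G ∈ Fact(X)} [0̂, G] → [0̂, X]
  -- is a poset isomorphism.  Fact(X) is enumerated by a duplicate-free list fs;
  -- an element of the product is a list ys with ys ᵢ ≤ fs ᵢ, ordered componentwise.
  record IsBuildingSet (𝒢 : Carrier → Set) : Set where
    field
      nonzero : ∀ G → 𝒢 G → ¬ (G ≡ 𝟘)
      factor  : ∀ X → ∃[ fs ] (Unique fs × (∀ G → G ∈ fs ⇔ IsFact 𝒢 X G)
        × (∀ Y → Y ≤ X → ∃[ ys ] (Pointwise _≤_ ys fs × ⋁ ys ≡ Y))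
        -- order isomorphism (monotone and order-reflecting, hence injective)
        × (∀ ys ys' → Pointwise _≤_ ys fs → Pointwise _≤_ ys' fs →
             (⋁ ys ≤ ⋁ ys' ⇔ Pointwise _≤_ ys ys')))

  InInd : (Carrier → Set) → Carrier → Carrier → Carrier → Set
  InInd 𝒢 G G' H = (∃[ F ] (𝒢 F × G ∨ F ≡ H)) × G ≤ H × H ≤ G' × ¬ (H ≡ G)

  -- F is a maximal element of {F ∈ 𝒢 : F ∨ G = H}.  By the paper this maximal
  -- element is unique for H ∈ Ind; it is Comp_G(H).
  IsComp : (Carrier → Set) → Carrier → Carrier → Carrier → Set
  IsComp 𝒢 G H F = 𝒢 F × F ∨ G ≡ H ×
    (∀ F' → 𝒢 F' → F' ∨ G ≡ H → F ≤ F' → F' ≡ F)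

-- Comp_G(H) ∨ G = H by definition of Comp_G, so H is recovered from its image
-- as Comp_G(H) ∨ G.
module Submission where

open import Data.Product using (_,_)
open import Relation.Binary.PropositionalEquality using (_≡_; refl; trans; sym)

open import Defs

module _ (L : FiniteLattice) (𝒢 : FiniteLattice.Carrier L → Set) where
  IsComp-injective : ∀ {G H₁ H₂ F} → IsComp L 𝒢 G H₁ F → IsComp L 𝒢 G H₂ F → H₁ ≡ H₂
  IsComp-injective (_ , F∨G≡H₁ , _) (_ , F∨G≡H₂ , _) = trans (sym F∨G≡H₁) F∨G≡H₂

mainTheorem2 : (L : FiniteLattice) → IsGeometric L →
    (𝒢 : FiniteLattice.Carrier L → Set) → IsBuildingSet L 𝒢 →
    (G G' : FiniteLattice.Carrier L) → _<_ L G G' →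
    ∀ H₁ H₂ → InInd L 𝒢 G G' H₁ → InInd L 𝒢 G G' H₂ →
    ∀ F₁ F₂ → IsComp L 𝒢 G H₁ F₁ → IsComp L 𝒢 G H₂ F₂ →
    F₁ ≡ F₂ → H₁ ≡ H₂
mainTheorem2 L _ 𝒢 _ G G' _ H₁ H₂ _ _ F₁ F₂ comp₁ comp₂ refl =
  IsComp-injective L 𝒢 comp₁ comp₂
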